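{- Let $\mathcal{A}\subseteq\binom{[n]}{r}$ be a compressed intersecting family and let $$\mathcal{B}=F(r,n,\{\{1,r+1\}\})\cup F(r,n,\{\{2,3,r+2\}\})\cup\bigcup_{s=3}^{r}F(r,n,\{[s,2s-1]\}).$$ If $\mathcal{A}\not\subseteq\mathcal{S}_{n,r}$ and $\mathcal{A}\not\subseteq F(r,n,\{[2,3]\})$, then $\mathcal{A}\subseteq\mathcal{B}$.
   Context: $[a,b]=\{a,\dots,b\}$, $[n]=[1,n]$; $\binom{[n]}{r}$ is the set of $r$-subsets of $[n]$ listed increasingly. A family is intersecting if any two members intersect. Compression order: $A\le B$ iff $a_i\le b_i$ for all $i$; $\mathcal{A}$ is compressed if $A\in\mathcal{A}$, $B\le A$ imply $B\in\mathcal{A}$. For $A=\{a_1<\dots<a_r\}$ and $C=\{c_1<\dots<c_k\}$, $A\prec C$ means $r\ge k$ and $a_i\le c_i$ for $1\le i\le k$. For $\mathcal{G}\subseteq2^{[n]}$, $F(r,n,\mathcal{G})=\{A\in\binom{[n]}{r}:A\prec G\text{ for some }G\in\mathcal{G}\}$. $\mathcal{S}_{n,r}=\{A\in\binom{[n]}{r}:1\in A\}$. -}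

module Defs where

open import Data.Nat using (ℕ; zero; suc; _+_; _∸_; _*_; _≤_; _<_)
open import Data.List using (List; []; _∷_; length; applyUpTo)
open import Data.List.Relation.Unary.All using (All)
open import Data.List.Relation.Unary.Linked using (Linked)
open import Data.List.Membership.Propositional using (_∈_; _∉_)
open import Data.Product using (_×_; ∃; ∃-syntax)
open import Data.Sum using (_⊎_)
open import Data.Unit using (⊤)
open import Data.Empty using (⊥)
open import Relation.Binary.PropositionalEquality using (_≡_)

-- A finite set of naturals is represented as its increasing list of elements.
-- An r-subset of [n] = {1,…,n}: strictly increasing list of length r, entries in [1,n].
IsRSubset : ℕ → ℕ → List ℕ → Set
IsRSubset n r A = Linked _<_ A × All (λ x → 1 ≤ x × x ≤ n) A × length A ≡ r

interval : ℕ → ℕ → List ℕ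
interval a b = applyUpTo (a +_) (suc b ∸ a)

-- A ≺ C : |A| ≥ |C| and a_i ≤ c_i for 1 ≤ i ≤ |C| (lists increasing).
-- For two sets of equal size this is exactly the compression order A ≤ C.
_≺_ : List ℕ → List ℕ → Set
_ ≺ [] = ⊤
[] ≺ (_ ∷ _) = ⊥
(a ∷ as) ≺ (c ∷ cs) = (a ≤ c) × (as ≺ cs)

Family : Set
Family = List (List ℕ)

FamilyOf : ℕ → ℕ → Family → Set
FamilyOf n r 𝒜 = ∀ A → A ∈ 𝒜 → IsRSubset n r A

Intersecting : Family → Set
Intersecting 𝒜 = ∀ A B → A ∈ 𝒜 → B ∈ 𝒜 → ∃[ x ] (x ∈ A × x ∈ B)

Compressed : ℕ → ℕ → Family → Set
Compressed n r 𝒜 = ∀ A B → A ∈ 𝒜 → IsRSubset n r B → B ≺ A → B ∈ 𝒜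

F : ℕ → ℕ → List ℕ → List ℕ → Set
F r n G A = IsRSubset n r A × A ≺ G

S : ℕ → ℕ → List ℕ → Set
S n r A = IsRSubset n r A × 1 ∈ A

_⊆ᶠ_ : Family → (List ℕ → Set) → Set
𝒜 ⊆ᶠ P = ∀ A → A ∈ 𝒜 → P A

ℬ : ℕ → ℕ → List ℕ → Set
ℬ r n A = F r n (1 ∷ (r + 1) ∷ []) A
        ⊎ F r n (2 ∷ 3 ∷ (r + 2) ∷ []) A
        ⊎ ∃[ s ] (3 ≤ s × s ≤ r × F r n (interval s (2 * s ∸ 1)) A)

-- Call A dense if a_s ≤ 2s − 1 for some s. Every member of 𝒜 is dense: otherwise a_s ≥ 2s for
-- all s, and pairing the numbers outside A, in increasing order, with the least still unpaired
-- element of A yields an r-set B disjoint from A with B ≤ A; by compression B ∈ 𝒜, contradicting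
-- intersection.
-- Compression also puts E = [2, r+1] (below a member avoiding 1) and D = {1} ∪ [4, r+2] (below a
-- member outside F(r,n,{[2,3]})) into 𝒜. Let A ∈ 𝒜. If a_1 = 1, then A meets E beyond a_1, so
-- a_2 ≤ r+1. Otherwise A is dense at some s ≥ 2: for s ≥ 3 this is A ≤ [s, 2s−1]; for s = 2 it
-- gives a_1 ≤ 2, a_2 ≤ 3, and A meets D beyond a_2, so a_3 ≤ r+2.
module Submission where

open import Data.Nat using (ℕ; zero; suc; _+_; _*_; _∸_; _≤_; _<_; z≤n; s≤s; _≟_; _≤?_)
open import Data.Nat.Properties
open import Data.Nat.Tactic.RingSolver using (solve-∀)
open import Data.List using (List; []; _∷_; _++_; [_]; length; applyUpTo)
open import Data.List.Properties using (length-++; ++-assoc)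
open import Data.List.Relation.Unary.All as All using (All; []; _∷_)
open import Data.List.Relation.Unary.All.Properties using (¬All⇒Any¬)
open import Data.List.Relation.Unary.AllPairs using (_∷_)
open import Data.List.Relation.Unary.Any using (here; there)
open import Data.List.Relation.Unary.Linked as Linked using (Linked; []; [-]; _∷_)
open import Data.List.Relation.Unary.Linked.Properties using (Linked⇒AllPairs; AllPairs⇒Linked)
open import Data.List.Relation.Binary.Pointwise as Pointwise using (Pointwise; []; _∷_; Pointwise-length)
open import Data.List.Membership.Propositional using (_∈_; _∉_; find)
open import Data.List.Membership.Propositional.Properties using (∉[])
open import Data.List.Membership.DecPropositional _≟_ using (_∈?_)
open import Data.Product using (∃-syntax; _×_; _,_; proj₁; proj₂)
open import Data.Sum using (_⊎_; inj₁; inj₂)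
open import Data.Unit using (⊤; tt)
open import Data.Empty using (⊥; ⊥-elim)
open import Relation.Nullary using (¬_; Dec; yes; no)
open import Relation.Unary using (Decidable)
open import Relation.Binary.PropositionalEquality using (_≡_; refl; sym; trans; cong; cong₂; subst; module ≡-Reasoning)

open import Defs

head<tail : ∀ {x xs} → Linked _<_ (x ∷ xs) → All (x <_) xs
head<tail inc with Linked⇒AllPairs <-trans inc
... | x<xs ∷ _ = x<xs

linked-∷ : ∀ {x xs} → All (x <_) xs → Linked _<_ xs → Linked _<_ (x ∷ xs)
linked-∷ x<xs inc = AllPairs⇒Linked (x<xs ∷ Linked⇒AllPairs <-trans inc)

All-≤-linked : ∀ {m a A} → m ≤ a → Linked _<_ (a ∷ A) → All (m ≤_) (a ∷ A)
All-≤-linked m≤a inc = m≤a ∷ All.map (λ a<x → ≤-trans m≤a (<⇒≤ a<x)) (head<tail inc)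

head≤ : ∀ {a x A} → Linked _<_ (a ∷ A) → x ∈ a ∷ A → a ≤ x
head≤ inc (here refl) = ≤-refl
head≤ inc (there x∈A) = <⇒≤ (All.lookup (head<tail inc) x∈A)

∈-tail : ∀ {a x A} → x ∈ a ∷ A → a < x → x ∈ A
∈-tail (here refl) a<a = ⊥-elim (<-irrefl refl a<a)
∈-tail (there x∈A) _ = x∈A

≺-singleton : ∀ {x v A} → Linked _<_ A → x ∈ A → x ≤ v → A ≺ (v ∷ [])
≺-singleton {A = _ ∷ _} inc x∈A x≤v = ≤-trans (head≤ inc x∈A) x≤v , tt

pointwise⇒≺ : ∀ {B A} → Pointwise _≤_ B A → B ≺ A
pointwise⇒≺ [] = tt
pointwise⇒≺ (b≤a ∷ B≤A) = b≤a , pointwise⇒≺ B≤A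

≺-All-≤ : ∀ {n} B A → B ≺ A → length B ≡ length A → All (_≤ n) A → All (_≤ n) B
≺-All-≤ [] [] _ _ _ = []
≺-All-≤ (b ∷ B) (a ∷ A) (b≤a , B≺A) len (a≤n ∷ A≤n) =
  ≤-trans b≤a a≤n ∷ ≺-All-≤ B A B≺A (suc-injective len) A≤n

_≺?_ : ∀ B A → Dec (B ≺ A)
B ≺? [] = yes tt
[] ≺? (a ∷ A) = no λ ()
(b ∷ B) ≺? (a ∷ A) with b ≤? a | B ≺? A
... | yes b≤a | yes B≺A = yes (b≤a , B≺A)
... | no b≰a  | _       = no λ B≺A → b≰a (proj₁ B≺A)
... | yes _   | no B⊀A  = no λ B≺A → B⊀A (proj₂ B≺A)

consecutive : ℕ → ℕ → List ℕ
consecutive m zero = []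
consecutive m (suc k) = m ∷ consecutive (suc m) k

applyUpTo≡consecutive : ∀ {f} m k → (∀ i → f i ≡ m + i) → applyUpTo f k ≡ consecutive m k
applyUpTo≡consecutive m zero f≗ = refl
applyUpTo≡consecutive m (suc k) f≗ =
  cong₂ _∷_ (trans (f≗ 0) (+-identityʳ m))
            (applyUpTo≡consecutive (suc m) k (λ i → trans (f≗ (suc i)) (+-suc m i)))

interval≡consecutive : ∀ s → interval (suc s) (2 * suc s ∸ 1) ≡ consecutive (suc s) (suc s)
interval≡consecutive s = trans (applyUpTo≡consecutive (suc s) _ (λ _ → refl))
  (cong (consecutive (suc s)) (trans (m+n∸m≡n s (suc s + 0)) (+-identityʳ (suc s))))

length-consecutive : ∀ m k → length (consecutive m k) ≡ k
length-consecutive m zero = refl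
length-consecutive m (suc k) = cong suc (length-consecutive (suc m) k)

consecutive-linked : ∀ m k → Linked _<_ (consecutive m k)
consecutive-linked m zero = []
consecutive-linked m (suc zero) = [-]
consecutive-linked m (suc (suc k)) = ≤-refl ∷ consecutive-linked (suc m) (suc k)

∈-consecutive⁻ : ∀ {x} m k → x ∈ consecutive m k → m ≤ x × x < m + k
∈-consecutive⁻ m (suc k) (here refl) = ≤-refl , m<m+n m (s≤s z≤n)
∈-consecutive⁻ {x} m (suc k) (there x∈) with ∈-consecutive⁻ (suc m) k x∈
... | m<x , x<m+k = <⇒≤ m<x , subst (x <_) (sym (+-suc m k)) x<m+k

consecutive-lower : ∀ m k → All (m ≤_) (consecutive m k)
consecutive-lower m k = All.tabulate λ x∈ → proj₁ (∈-consecutive⁻ m k x∈)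

consecutive-≺ : ∀ {m} B → Linked _<_ B → All (m ≤_) B → consecutive m (length B) ≺ B
consecutive-≺ [] _ _ = tt
consecutive-≺ {m} (b ∷ B) inc (m≤b ∷ _) =
  m≤b , consecutive-≺ B (Linked.tail inc) (All.map (≤-<-trans m≤b) (head<tail inc))

-- Indices count from 0.
At : ℕ → List ℕ → (ℕ → Set) → Set
At i [] P = ⊥
At zero (a ∷ A) P = P a
At (suc i) (a ∷ A) P = At i A P

At-map : ∀ {P Q : ℕ → Set} i A → (∀ {x} → P x → Q x) → At i A P → At i A Q
At-map zero (a ∷ A) P⇒Q p = P⇒Q p
At-map (suc i) (a ∷ A) P⇒Q p = At-map i A P⇒Q p

At-length : ∀ {P} i A → At i A P → i < length A
At-length zero (a ∷ A) _ = s≤s z≤n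
At-length (suc i) (a ∷ A) p = s≤s (At-length i A p)

≺-consecutive : ∀ m k A → Linked _<_ A → At k A (_≤ m + k) → A ≺ consecutive m (suc k)
≺-consecutive m zero (a ∷ A) _ a≤m+0 = subst (a ≤_) (+-identityʳ m) a≤m+0 , tt
≺-consecutive m (suc k) (a ∷ A@(a′ ∷ _)) inc at
  with ≺-consecutive (suc m) k A (Linked.tail inc) (At-map k A (λ {x} x≤ → subst (x ≤_) (+-suc m k) x≤) at)
... | a′≤1+m , A≺ = ≤-pred (≤-trans (Linked.head inc) a′≤1+m) , a′≤1+m , A≺

≺-interval : ∀ i A → Linked _<_ A → At i A (_< 2 * i + 2) → A ≺ interval (suc i) (2 * suc i ∸ 1)
≺-interval i A inc at = subst (A ≺_) (sym (interval≡consecutive i))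
  (≺-consecutive (suc i) i A inc (At-map i A (λ {x} x< → ≤-pred (subst (x <_) (2i+2≡1+[1+i+i] i) x<)) at))
  where
  2i+2≡1+[1+i+i] : ∀ i → 2 * i + 2 ≡ suc (suc i + i)
  2i+2≡1+[1+i+i] = solve-∀

Sparse : ℕ → List ℕ → Set
Sparse c [] = ⊤
Sparse c (a ∷ A) = c ≤ a × Sparse (2 + c) A

Dense : ℕ → List ℕ → Set
Dense c A = ∃[ i ] At i A (_< 2 * i + c)

sparse⊎dense : ∀ c A → Sparse c A ⊎ Dense c A
sparse⊎dense c [] = inj₁ tt
sparse⊎dense c (a ∷ A) with c ≤? a | sparse⊎dense (2 + c) A
... | no c≰a  | _               = inj₂ (0 , ≰⇒> c≰a)
... | yes c≤a | inj₁ sparse     = inj₁ (c≤a , sparse)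
... | yes _   | inj₂ (i , a<)   =
  inj₂ (suc i , At-map i A (λ {x} x< → subst (x <_) (2i+[2+c]≡2[1+i]+c i c) x<) a<)
  where
  2i+[2+c]≡2[1+i]+c : ∀ i c → 2 * i + (2 + c) ≡ 2 * suc i + c
  2i+[2+c]≡2[1+i]+c = solve-∀

record Shadow (m : ℕ) (X T : List ℕ) : Set where
  field
    elements   : List ℕ
    increasing : Linked _<_ elements
    lower      : All (m ≤_) elements
    below      : Pointwise _<_ elements T
    avoids     : All (_∉ X) elements

shadow-[] : ∀ {m X} → Shadow m X []
shadow-[] = record { elements = [] ; increasing = [] ; lower = [] ; below = [] ; avoids = [] }

shadow-∷ : ∀ {m X t T} → All (m <_) X → m < t → Shadow (suc m) X T → Shadow m X (t ∷ T)
shadow-∷ {m} m<X m<t S = record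
  { elements   = m ∷ elements
  ; increasing = linked-∷ lower increasing
  ; lower      = ≤-refl ∷ All.map <⇒≤ lower
  ; below      = m<t ∷ below
  ; avoids     = (λ m∈X → <-irrefl refl (All.lookup m<X m∈X)) ∷ avoids
  }
  where open Shadow S

shadow-skip : ∀ {m X T} → Shadow (suc m) X T → Shadow m (m ∷ X) T
shadow-skip {m} {X} S = record
  { elements   = elements
  ; increasing = increasing
  ; lower      = All.map <⇒≤ lower
  ; below      = below
  ; avoids     = All.zipWith avoid-m (lower , avoids)
  }
  where
  open Shadow S
  avoid-m : ∀ {b} → m < b × b ∉ X → b ∉ m ∷ X
  avoid-m (m<b , _) (here refl) = <-irrefl refl m<b
  avoid-m (_ , b∉X) (there b∈X) = b∉X b∈X

pairing-invariant : ∀ m (P : List ℕ) t {c} → m + length P < c → suc m + length (P ++ [ t ]) < 2 + c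
pairing-invariant m P t {c} inv = subst (_< 2 + c) (sym shift) (s≤s (s≤s inv))
  where
  shift : suc m + length (P ++ [ t ]) ≡ 2 + (m + length P)
  shift = begin
    suc m + length (P ++ [ t ]) ≡⟨ cong (suc m +_) (length-++ P) ⟩
    suc m + (length P + 1)      ≡⟨ 1+m+[k+1]≡2+[m+k] m (length P) ⟩
    2 + (m + length P)          ∎
    where
    open ≡-Reasoning
    1+m+[k+1]≡2+[m+k] : ∀ m k → suc m + (k + 1) ≡ 2 + (m + k)
    1+m+[k+1]≡2+[m+k] = solve-∀

-- Scanning m upwards, X = P ++ T lists the elements of A that are ≥ m: P those already paired, T
-- those still unpaired. A number m ∉ X is paired with the head t of T, and m + |P| < c ≤ t gives m < t.
greedy-shadow : ∀ m c P T {X} → X ≡ P ++ T → Linked _<_ X → All (m ≤_) X →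
                m + length P < c → Sparse c T → Shadow m X T
greedy-shadow-∷ : ∀ m c P t T {X} → X ≡ P ++ t ∷ T → Linked _<_ X → All (m ≤_) X →
                  m + length P < c → c ≤ t → Sparse (2 + c) T → Shadow m X (t ∷ T)

greedy-shadow m c P [] _ _ _ _ _ = shadow-[]
greedy-shadow m c P (t ∷ T) eq inc low inv (c≤t , sparse) = greedy-shadow-∷ m c P t T eq inc low inv c≤t sparse

greedy-shadow-∷ m c [] t T refl inc _ inv c≤t sparse =
  shadow-∷ m<X m<t (greedy-shadow (suc m) (2 + c) [ t ] T refl inc m<X (pairing-invariant m [] t inv) sparse)
  where
  m<t : m < t
  m<t = <-≤-trans (subst (_< c) (+-identityʳ m) inv) c≤t
  m<X : All (m <_) (t ∷ T)
  m<X = m<t ∷ All.map (<-trans m<t) (head<tail inc)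
greedy-shadow-∷ m c (p ∷ P) t T refl inc (m≤p ∷ _) inv c≤t sparse with p ≟ m
... | yes refl = shadow-skip
  (greedy-shadow-∷ (suc m) c P t T refl (Linked.tail inc) (head<tail inc)
    (subst (_< c) (+-suc m (length P)) inv) c≤t sparse)
... | no p≢m = shadow-∷ m<X m<t
  (greedy-shadow (suc m) (2 + c) (p ∷ P ++ [ t ]) T (sym (++-assoc (p ∷ P) [ t ] T)) inc m<X
    (pairing-invariant m (p ∷ P) t inv) sparse)
  where
  m<p : m < p
  m<p = ≤∧≢⇒< m≤p (λ m≡p → p≢m (sym m≡p))
  m<X : All (m <_) (p ∷ P ++ t ∷ T)
  m<X = m<p ∷ All.map (<-trans m<p) (head<tail inc)
  m<t : m < t
  m<t = <-≤-trans (≤-<-trans (m≤m+n m (length (p ∷ P))) inv) c≤t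

downward-closed : ∀ {n r 𝒜 A} B → Compressed n r 𝒜 → A ∈ 𝒜 → IsRSubset n r A →
                  Linked _<_ B → All (1 ≤_) B → length B ≡ r → B ≺ A → B ∈ 𝒜
downward-closed {A = A} B compressed A∈𝒜 (_ , A-bounds , |A|≡r) B-inc B-pos |B|≡r B≺A =
  compressed A B A∈𝒜
    (B-inc , All.zip (B-pos , ≺-All-≤ B A B≺A (trans |B|≡r (sym |A|≡r)) (All.map proj₂ A-bounds)) , |B|≡r)
    B≺A

member-dense : ∀ {n r 𝒜 A} → FamilyOf n r 𝒜 → Compressed n r 𝒜 → Intersecting 𝒜 → A ∈ 𝒜 → Dense 2 A
member-dense {n} {r} {𝒜} {A} family compressed intersecting A∈𝒜 with sparse⊎dense 2 A
... | inj₂ dense = dense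
... | inj₁ sparse = ⊥-elim (let x , x∈A , x∈B = intersecting A B A∈𝒜 B∈𝒜 in All.lookup avoids x∈B x∈A)
  where
  isA : IsRSubset n r A
  isA = family A A∈𝒜
  open Shadow (greedy-shadow 1 2 [] A refl (proj₁ isA) (All.map proj₁ (proj₁ (proj₂ isA))) (s≤s (s≤s z≤n)) sparse)
    renaming (elements to B)
  B∈𝒜 : B ∈ 𝒜
  B∈𝒜 = downward-closed B compressed A∈𝒜 isA increasing lower
          (trans (Pointwise-length below) (proj₂ (proj₂ isA))) (pointwise⇒≺ (Pointwise.map <⇒≤ below))

consecutive-2∈ : ∀ {n r 𝒜 B} → FamilyOf n r 𝒜 → Compressed n r 𝒜 → B ∈ 𝒜 → 1 ∉ B → consecutive 2 r ∈ 𝒜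
consecutive-2∈ {n} {r} {B = B} family compressed B∈𝒜 1∉B =
  downward-closed (consecutive 2 r) compressed B∈𝒜 isB (consecutive-linked 2 r)
    (All.map <⇒≤ (consecutive-lower 2 r)) (length-consecutive 2 r)
    (subst (λ k → consecutive 2 k ≺ B) (proj₂ (proj₂ isB)) (consecutive-≺ B (proj₁ isB) B≥2))
  where
  isB : IsRSubset n r B
  isB = family B B∈𝒜
  B≥2 : All (2 ≤_) B
  B≥2 = All.tabulate λ {x} x∈B →
    ≤∧≢⇒< (proj₁ (All.lookup (proj₁ (proj₂ isB)) x∈B)) (λ 1≡x → 1∉B (subst (_∈ B) (sym 1≡x) x∈B))

tail≥4 : ∀ {c C} → Linked _<_ (c ∷ C) → ¬ ((c ∷ C) ≺ (2 ∷ 3 ∷ [])) → All (4 ≤_) C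
tail≥4 {C = []} _ _ = []
tail≥4 {c} {c′ ∷ C} inc C⊀[2,3] with 4 ≤? c′
... | yes 4≤c′ = All-≤-linked 4≤c′ (Linked.tail inc)
... | no 4≰c′ = ⊥-elim (C⊀[2,3] (≤-pred (≤-pred (≤-trans (s≤s (Linked.head inc)) c′<4)) , ≤-pred c′<4 , tt))
  where
  c′<4 : c′ < 4
  c′<4 = ≰⇒> 4≰c′

1∷consecutive-4∈ : ∀ {n r 𝒜 C} → FamilyOf n (suc r) 𝒜 → Compressed n (suc r) 𝒜 → C ∈ 𝒜 →
                   ¬ (C ≺ (2 ∷ 3 ∷ [])) → (1 ∷ consecutive 4 r) ∈ 𝒜
1∷consecutive-4∈ {C = C} family compressed C∈𝒜 C⊀[2,3] with family C C∈𝒜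
1∷consecutive-4∈ {r = r} {C = c ∷ C} family compressed C∈𝒜 C⊀[2,3] | isC@(inc , c≥1 ∷ _ , |C|≡1+r) =
  downward-closed (1 ∷ consecutive 4 r) compressed C∈𝒜 isC (linked-∷ 1<D (consecutive-linked 4 r))
    (≤-refl ∷ All.map <⇒≤ 1<D) (cong suc (length-consecutive 4 r))
    (proj₁ c≥1 , subst (λ k → consecutive 4 k ≺ C) (suc-injective |C|≡1+r)
                   (consecutive-≺ C (Linked.tail inc) (tail≥4 inc C⊀[2,3])))
  where
  1<D : All (1 <_) (consecutive 4 r)
  1<D = All.map (≤-trans (s≤s (s≤s z≤n))) (consecutive-lower 4 r)

∃-outside : ∀ {n r 𝒜} {P : List ℕ → Set} → FamilyOf n r 𝒜 → Decidable P →
            ¬ (𝒜 ⊆ᶠ (λ A → IsRSubset n r A × P A)) → ∃[ A ] (A ∈ 𝒜 × ¬ P A)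
∃-outside {𝒜 = 𝒜} family P? 𝒜⊈P =
  find (¬All⇒Any¬ P? 𝒜 (λ 𝒜⊆P → 𝒜⊈P (λ A A∈𝒜 → family A A∈𝒜 , All.lookup 𝒜⊆P A∈𝒜)))

<1+m+k⇒≤k+m : ∀ m k {x} → x < suc m + k → x ≤ k + m
<1+m+k⇒≤k+m m k {x} x< = subst (x ≤_) (+-comm m k) (≤-pred x<)

meets-consecutive-2⇒≺ : ∀ {r a A} → Linked _<_ (a ∷ A) → a ≤ 1 →
                  ∃[ x ] (x ∈ a ∷ A × x ∈ consecutive 2 r) → (a ∷ A) ≺ (1 ∷ r + 1 ∷ [])
meets-consecutive-2⇒≺ {r} inc a≤1 (x , x∈A , x∈E) with ∈-consecutive⁻ 2 r x∈E
... | 2≤x , x<2+r = a≤1 , ≺-singleton (Linked.tail inc) (∈-tail x∈A (≤-<-trans a≤1 2≤x)) (<1+m+k⇒≤k+m 1 r x<2+r)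

meets-1∷consecutive-4⇒≺ : ∀ {r a a₂ A} → Linked _<_ (a ∷ a₂ ∷ A) → 1 < a → a ≤ 2 → a₂ ≤ 3 →
                  ∃[ y ] (y ∈ a ∷ a₂ ∷ A × y ∈ 1 ∷ consecutive 4 r) → (a ∷ a₂ ∷ A) ≺ (2 ∷ 3 ∷ suc r + 2 ∷ [])
meets-1∷consecutive-4⇒≺ {r} {A = A} inc 1<a a≤2 a₂≤3 (y , y∈A , y∈D)
  with ∈-consecutive⁻ 4 r (∈-tail y∈D (<-≤-trans 1<a (head≤ inc y∈A)))
... | 4≤y , y<4+r = a≤2 , a₂≤3 , ≺-singleton (Linked.tail (Linked.tail inc)) y∈A′ (<1+m+k⇒≤k+m 2 (suc r) y<4+r)
  where
  y∈A′ : y ∈ A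
  y∈A′ = ∈-tail (∈-tail y∈A (≤-<-trans a≤2 (≤-trans (s≤s (s≤s (s≤s z≤n))) 4≤y))) (<-≤-trans (s≤s a₂≤3) 4≤y)

dense-beyond-1⇒ℬ : ∀ {n r a A} → IsRSubset n (suc r) (a ∷ A) → 1 < a → Dense 2 (a ∷ A) →
                   ∃[ y ] (y ∈ a ∷ A × y ∈ 1 ∷ consecutive 4 r) → ℬ (suc r) n (a ∷ A)
dense-beyond-1⇒ℬ _ 1<a (zero , a<2) _ = ⊥-elim (<⇒≱ 1<a (≤-pred a<2))
dense-beyond-1⇒ℬ {A = []} _ _ (suc zero , ()) _
dense-beyond-1⇒ℬ {A = a₂ ∷ A} isA@(inc , _) 1<a (suc zero , at) meets-D with ≺-interval 1 _ inc at
... | a≤2 , a₂≤3 , _ = inj₂ (inj₁ (isA , meets-1∷consecutive-4⇒≺ inc 1<a a≤2 a₂≤3 meets-D))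
dense-beyond-1⇒ℬ {r = r} {a} {A} isA@(inc , _ , |A|≡1+r) _ (suc (suc j) , at) _ =
  inj₂ (inj₂ (3 + j , s≤s (s≤s (s≤s z≤n)) , s≤1+r , isA , ≺-interval (2 + j) (a ∷ A) inc at))
  where
  s≤1+r : 3 + j ≤ suc r
  s≤1+r = subst (3 + j ≤_) |A|≡1+r (At-length (2 + j) (a ∷ A) at)

dense⇒ℬ : ∀ {n r A} → IsRSubset n (suc r) A → Dense 2 A →
          ∃[ x ] (x ∈ A × x ∈ consecutive 2 (suc r)) → ∃[ y ] (y ∈ A × y ∈ 1 ∷ consecutive 4 r) →
          ℬ (suc r) n A
dense⇒ℬ {A = a ∷ A} isA dense meets-E meets-D with a ≤? 1
... | yes a≤1 = inj₁ (isA , meets-consecutive-2⇒≺ (proj₁ isA) a≤1 meets-E)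
... | no a≰1 = dense-beyond-1⇒ℬ isA (≰⇒> a≰1) dense meets-D

proposition20 : (n r : ℕ) (𝒜 : Family) → FamilyOf n r 𝒜 → Compressed n r 𝒜 → Intersecting 𝒜 → ¬ (𝒜 ⊆ᶠ S n r) → ¬ (𝒜 ⊆ᶠ F r n (interval 2 3)) → 𝒜 ⊆ᶠ ℬ r n
proposition20 n zero 𝒜 family _ intersecting _ _ [] A∈𝒜 = ⊥-elim (∉[] (proj₁ (proj₂ (intersecting [] [] A∈𝒜 A∈𝒜))))
proposition20 n zero 𝒜 family _ _ _ _ (_ ∷ _) A∈𝒜 = ⊥-elim (1+n≢0 (proj₂ (proj₂ (family _ A∈𝒜))))
proposition20 n (suc r) 𝒜 family compressed intersecting 𝒜⊈S 𝒜⊈F[2,3] A A∈𝒜 =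
  dense⇒ℬ (family A A∈𝒜) (member-dense family compressed intersecting A∈𝒜)
    (intersecting A _ A∈𝒜 E∈𝒜) (intersecting A _ A∈𝒜 D∈𝒜)
  where
  E∈𝒜 : consecutive 2 (suc r) ∈ 𝒜
  E∈𝒜 with ∃-outside family (1 ∈?_) 𝒜⊈S
  ... | B , B∈𝒜 , 1∉B = consecutive-2∈ family compressed B∈𝒜 1∉B
  D∈𝒜 : 1 ∷ consecutive 4 r ∈ 𝒜
  D∈𝒜 with ∃-outside family (_≺? (2 ∷ 3 ∷ [])) 𝒜⊈F[2,3]
  ... | C , C∈𝒜 , C⊀[2,3] = 1∷consecutive-4∈ family compressed C∈𝒜 C⊀[2,3]
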